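{- Let $n\ge 0$. Let $\mathcal{G}_n^{[-1,1]}$ be the set of GDAP of length $n$ all of whose vertices have ordinate in $\{ -1,0,1\}$, and let $\mathcal{C}'(n+3)$ be the set of compositions of $n+3$ (ordered sequences of positive integers summing to $n+3$) whose first part is odd, whose last part is even, and in which no two consecutive parts have the same parity. Define $\phi:\mathcal{G}_n^{[-1,1]}\to\mathcal{C}'(n+3)$ as follows. For the empty path, $\phi(\varepsilon)=(1,2)$. For nonempty $\alpha$, if $\alpha$ contains neither the factor $UU$ nor the factor $UD_2$ (equivalently $\alpha=(UD)^{n/2}$ or $\alpha=(DU)^{n/2}$ with $n$ even), set $\phi((UD)^{n/2})=(n+1,2)$ and $\phi((DU)^{n/2})=(1,n+2)$. Otherwise write $\alpha=B_1B_2\cdots B_r$ (with $r\ge 2$) by cutting $\alpha$ immediately after each up-step that is followed by another up-step or by a $D_2$-step, let $b_i$ be the length of $B_i$, and let $L$ be the reversed sequence $(b_r,b_{r-1},\dots,b_1)$. Then modify $L$ as follows: if $b_{r-1}$ is even, add $1$ to the entry $b_r$, otherwise prepend a part $1$ at the beginning of $L$; then, if $b_1$ is even, add $2$ to the entry $b_1$, otherwise append a part $2$ at the end of $L$. The resulting sequence is $\phi(\alpha)$. Then $\phi$ is a bijection from $\mathcal{G}_n^{[-1,1]}$ onto $\mathcal{C}'(n+3)$.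
   Context: A grand Dyck path with air pockets (GDAP) is a lattice path in $\mathbb{Z}^2$ starting at $(0,0)$ and ending on the $x$-axis, consisting of up-steps $U=(1,1)$ and down-steps $D_k=(1,-k)$ with $k\ge 1$, such that no two down-steps are consecutive; the path may go below the $x$-axis, and the empty path $\varepsilon$ is a GDAP. The length of a path is its number of steps; $D$ denotes $D_1$. -}

module Defs where

open import Data.Nat using (ℕ; zero; suc; _+_; _≤_)
open import Data.Integer as ℤ using (ℤ; +_; -[1+_]; -_)
open import Data.List using (List; []; _∷_; length; map; reverse)
open import Data.Nat.ListAction using (sum)
open import Data.List.Relation.Unary.All using (All)
open import Data.Bool using (Bool; true; false; if_then_else_; not)
open import Data.Product using (_×_; ∃)
open import Data.Sum using (_⊎_)
open import Data.Unit using (⊤)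
open import Data.Empty using (⊥)
open import Relation.Binary.PropositionalEquality using (_≡_; _≢_)

-- Steps: U = (1,1) and D k = (1,-k); a legal down-step needs k ≥ 1.

data Step : Set where
  U : Step
  D : ℕ → Step

δ : Step → ℤ
δ U     = + 1
δ (D k) = - (+ k)

Path : Set
Path = List Step

isDown : Step → Bool
isDown U     = false
isDown (D _) = true

DownStepsLegal : Path → Set
DownStepsLegal α = All (λ s → s ≡ U ⊎ ∃ λ k → s ≡ D (suc k)) α

NoDD : Path → Set
NoDD []            = ⊤
NoDD (s ∷ [])      = ⊤
NoDD (s ∷ t ∷ xs)  = (isDown s ≡ true → isDown t ≡ false) × NoDD (t ∷ xs)

endHeight : ℤ → Path → ℤ
endHeight h []       = h
endHeight h (s ∷ xs) = endHeight (h ℤ.+ δ s) xs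

GDAP : Path → Set
GDAP α = DownStepsLegal α × NoDD α × endHeight (+ 0) α ≡ + 0

Band : ℤ → Set
Band h = h ≡ -[1+ 0 ] ⊎ h ≡ + 0 ⊎ h ≡ + 1

InBand : ℤ → Path → Set
InBand h []       = Band h
InBand h (s ∷ xs) = Band h × InBand (h ℤ.+ δ s) xs

G : ℕ → Path → Set
G n α = GDAP α × length α ≡ n × InBand (+ 0) α

even : ℕ → Bool
even zero    = true
even (suc n) = not (even n)

FirstOdd : List ℕ → Set
FirstOdd []      = ⊥
FirstOdd (x ∷ _) = even x ≡ false

LastEven : List ℕ → Set
LastEven []           = ⊥
LastEven (x ∷ [])     = even x ≡ true
LastEven (x ∷ y ∷ xs) = LastEven (y ∷ xs)

Alternating : List ℕ → Set
Alternating []           = ⊤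
Alternating (x ∷ [])     = ⊤
Alternating (x ∷ y ∷ xs) = even x ≢ even y × Alternating (y ∷ xs)

Composition : ℕ → List ℕ → Set
Composition m c = All (λ p → 1 ≤ p) c × sum c ≡ m

C' : ℕ → List ℕ → Set
C' m c = Composition m c × FirstOdd c × LastEven c × Alternating c

-- a cut is made right after an up-step that is followed by U or by D₂
cutBefore : Step → Bool
cutBefore U                   = true
cutBefore (D (suc (suc zero))) = true
cutBefore (D _)               = false

consHead : Step → List Path → List Path
consHead s []       = (s ∷ []) ∷ []
consHead s (b ∷ bs) = (s ∷ b) ∷ bs

blocks : Path → List Path
blocks []           = [] ∷ []
blocks (U ∷ [])     = (U ∷ []) ∷ []
blocks (U ∷ x ∷ xs) = if cutBefore x then (U ∷ []) ∷ blocks (x ∷ xs)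
                                     else consHead U (blocks (x ∷ xs))
blocks (D k ∷ xs)   = consHead (D k) (blocks xs)

-- first modification, on L = (b_r, b_{r-1}, …): looks at b_{r-1}
modify₁ : List ℕ → List ℕ
modify₁ (x ∷ y ∷ t) = if even y then suc x ∷ y ∷ t else 1 ∷ x ∷ y ∷ t
modify₁ l           = l

-- second modification, on the reversed list (b_1, …): looks at b_1
modify₂ʳ : List ℕ → List ℕ
modify₂ʳ (z ∷ t) = if even z then (z + 2) ∷ t else 2 ∷ z ∷ t
modify₂ʳ []      = []

φ : Path → List ℕ
φ []            = 1 ∷ 2 ∷ []
φ α@(s ∷ _) with blocks α
... | _ ∷ [] = special s
  where
    -- no factor UU or UD₂: α = (UD)^{n/2} or (DU)^{n/2}
    special : Step → List ℕ
    special U     = suc (length α) ∷ 2 ∷ []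
    special (D _) = 1 ∷ (length α + 2) ∷ []
... | bs = reverse (modify₂ʳ (reverse (modify₁ (reverse (map length bs)))))

{-# OPTIONS --safe #-}
-- A path confined to [-1,1] is described by a grammar with one state for height 0 and one for
-- height 1, so it factors uniquely as
--   (DU)^a · U(DU)^{i₁} D₂U(DU)^{j₁} ⋯ U(DU)^{iₖ} D₂U(DU)^{jₖ} · (UD)^b,
-- and the cuts defining φ fall exactly between these factors, of lengths 2a, 2i+1, 2j+2, 2b.
-- Reversing and applying the two modifications turns the outer runs into 2b+1 and 2a+2, so
--   φ = (2b+1, 2jₖ+2, 2iₖ+1, …, 2j₁+2, 2i₁+1, 2a+2);
-- the one-block paths (DU)^a and (UD)^b, treated separately by φ, fit the same formula.
-- Conversely alternation of parities forces every composition in 𝒞' into this shape, with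
-- (a, (i, j)'s, b) read off uniquely, and the parts sum to the length of the path plus 3.
module Submission where

open import Defs
open import Data.Nat using (ℕ; zero; suc; _+_; _≤_; s≤s; z≤n)
open import Data.Nat.Properties using (suc-injective; +-comm; +-assoc; +-cancelʳ-≡)
open import Data.Nat.Tactic.RingSolver using (solve-∀)
open import Data.Nat.ListAction using (sum)
open import Data.Nat.ListAction.Properties using (sum-++; sum-↭)
open import Data.Integer as ℤ using (ℤ; +_; -[1+_])
open import Data.List using (List; []; _∷_; _++_; _∷ʳ_; length; reverse; map)
open import Data.List.Properties
  using (∷-injective; ∷ʳ-injective; ++-assoc; ++-identityʳ; length-++; map-++;
         unfold-reverse; reverse-++; reverse-involutive; reverse-injective)
open import Data.List.Relation.Binary.Permutation.Propositional.Properties using (↭-reverse)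
open import Data.List.Relation.Unary.All using (All; []; _∷_)
open import Data.List.Relation.Unary.All.Properties using (++⁺)
open import Data.Bool using (true; false; not)
open import Data.Bool.Properties using (¬-not)
open import Data.Product using (Σ; _×_; _,_; ∃₂; ∃-syntax)
open import Data.Sum using (_⊎_; inj₁; inj₂)
open import Data.Unit using (⊤; tt)
open import Data.Empty using (⊥; ⊥-elim)
open import Function using (_∘_)
open import Relation.Nullary using (¬_; contradiction)
open import Relation.Binary.PropositionalEquality
open ≡-Reasoning

double : ℕ → ℕ
double zero    = zero
double (suc n) = suc (suc (double n))

odd : ℕ → ℕ
odd i = suc (double i)

even⁺ : ℕ → ℕ
even⁺ j = double (suc j)

even-double : ∀ k → even (double k) ≡ true
even-double zero    = refl
even-double (suc k) rewrite even-double k = refl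

even-odd : ∀ k → even (odd k) ≡ false
even-odd k rewrite even-double k = refl

double-injective : ∀ {m n} → double m ≡ double n → m ≡ n
double-injective {zero}  {zero}  _  = refl
double-injective {suc m} {suc n} eq = cong suc (double-injective (suc-injective (suc-injective eq)))
double-injective {zero}  {suc n} ()
double-injective {suc m} {zero}  ()

odd-injective : ∀ {m n} → odd m ≡ odd n → m ≡ n
odd-injective = double-injective ∘ suc-injective

even⁺-injective : ∀ {m n} → even⁺ m ≡ even⁺ n → m ≡ n
even⁺-injective = suc-injective ∘ double-injective

data Parity : ℕ → Set where
  even-form : ∀ k → Parity (double k)
  odd-form  : ∀ k → Parity (odd k)

parity : ∀ n → Parity n
parity zero = even-form zero
parity (suc n) with parity n
... | even-form k = odd-form k
... | odd-form k  = even-form (suc k)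

odd-view : ∀ n → even n ≡ false → ∃[ i ] n ≡ odd i
odd-view n e with parity n
... | odd-form i  = i , refl
... | even-form k = contradiction (trans (sym (even-double k)) e) λ ()

even⁺-view : ∀ n → even n ≡ true → 1 ≤ n → ∃[ j ] n ≡ even⁺ j
even⁺-view n e pos with parity n
... | even-form (suc j) = j , refl
... | odd-form i        = contradiction (trans (sym (even-odd i)) e) λ ()
even⁺-view .zero e () | even-form zero

parity-flips : ∀ x y {p} → even x ≢ even y → even x ≡ p → even y ≡ not p
parity-flips x y x≢y refl = ¬-not (x≢y ∘ sym)

odd≢even⁺ : ∀ i j → even (odd i) ≢ even (even⁺ j)
odd≢even⁺ i j eq = contradiction (trans (sym (even-odd i)) (trans eq (even-double (suc j)))) λ ()

BandPath : ℤ → Path → Set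
BandPath h α = DownStepsLegal α × NoDD α × InBand h α × endHeight h α ≡ + 0

-- In the band a down-step is D from height 0 (then U follows), D from height 1 (then U follows
-- or the path ends) or D₂ from height 1 (then U follows).
data Banded₀ : Path → Set
data Banded₁ : Path → Set

data Banded₀ where
  []   : Banded₀ []
  U∷_  : ∀ {α} → Banded₁ α → Banded₀ (U ∷ α)
  DU∷_ : ∀ {α} → Banded₀ α → Banded₀ (D 1 ∷ U ∷ α)

data Banded₁ where
  D∷[]  : Banded₁ (D 1 ∷ [])
  DU∷_  : ∀ {α} → Banded₁ α → Banded₁ (D 1 ∷ U ∷ α)
  D₂U∷_ : ∀ {α} → Banded₀ α → Banded₁ (D 2 ∷ U ∷ α)

band₋₁ : Band -[1+ 0 ]
band₋₁ = inj₁ refl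

band₀ : Band (+ 0)
band₀ = inj₂ (inj₁ refl)

band₁ : Band (+ 1)
band₁ = inj₂ (inj₂ refl)

below-band : ∀ k → ¬ Band -[1+ suc k ]
below-band k (inj₁ ())
below-band k (inj₂ (inj₁ ()))
below-band k (inj₂ (inj₂ ()))

above-band : ¬ Band (+ 2)
above-band (inj₁ ())
above-band (inj₂ (inj₁ ()))
above-band (inj₂ (inj₂ ()))

headBand : ∀ {h} α → InBand h α → Band h
headBand []      b       = b
headBand (_ ∷ _) (b , _) = b

D₀-illegal : ¬ (D 0 ≡ U ⊎ ∃[ k ] D 0 ≡ D (suc k))
D₀-illegal (inj₁ ())
D₀-illegal (inj₂ (_ , ()))

¬NoDD-DD : ∀ k k′ α → ¬ NoDD (D k ∷ D k′ ∷ α)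
¬NoDD-DD _ _ _ (noDD , _) = contradiction (noDD refl) λ ()

NoDD-tail : ∀ s α → NoDD (s ∷ α) → NoDD α
NoDD-tail s []      _       = tt
NoDD-tail s (_ ∷ _) (_ , n) = n

NoDD-U : ∀ {α} → NoDD α → NoDD (U ∷ α)
NoDD-U {[]}    _ = tt
NoDD-U {_ ∷ _} n = (λ ()) , n

bandPath-tail : ∀ {h s α} → BandPath h (s ∷ α) → BandPath (h ℤ.+ δ s) α
bandPath-tail {s = s} {α} (_ ∷ ℓ , n , (_ , b) , e) = ℓ , NoDD-tail s α n , b , e

bandPath-U : ∀ {h α} → Band h → BandPath (h ℤ.+ + 1) α → BandPath h (U ∷ α)
bandPath-U b (ℓ , n , ib , e) = inj₁ refl ∷ ℓ , NoDD-U n , (b , ib) , e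

bandPath-DU : ∀ {h k α} → Band h → BandPath (h ℤ.+ ℤ.- (+ suc k)) (U ∷ α) →
  BandPath h (D (suc k) ∷ U ∷ α)
bandPath-DU b (ℓ , n , ib , e) = inj₂ (_ , refl) ∷ ℓ , ((λ _ → refl) , n) , (b , ib) , e

bandPath⇒banded₀ : ∀ α → BandPath (+ 0) α → Banded₀ α
bandPath⇒banded₁ : ∀ α → BandPath (+ 1) α → Banded₁ α

bandPath⇒banded₀ [] _ = []
bandPath⇒banded₀ (U ∷ α) v = U∷ bandPath⇒banded₁ α (bandPath-tail v)
bandPath⇒banded₀ (D 0 ∷ α) (ℓ ∷ _ , _) = ⊥-elim (D₀-illegal ℓ)
bandPath⇒banded₀ (D 1 ∷ []) (_ , _ , _ , ())
bandPath⇒banded₀ (D 1 ∷ U ∷ α) v = DU∷ bandPath⇒banded₀ α (bandPath-tail (bandPath-tail v))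
bandPath⇒banded₀ (D 1 ∷ D k ∷ α) (_ , n , _) = ⊥-elim (¬NoDD-DD 1 k α n)
bandPath⇒banded₀ (D (suc (suc k)) ∷ α) (_ , _ , (_ , b) , _) = ⊥-elim (below-band k (headBand α b))

bandPath⇒banded₁ [] (_ , _ , _ , ())
bandPath⇒banded₁ (U ∷ α) (_ , _ , (_ , b) , _) = ⊥-elim (above-band (headBand α b))
bandPath⇒banded₁ (D 0 ∷ α) (ℓ ∷ _ , _) = ⊥-elim (D₀-illegal ℓ)
bandPath⇒banded₁ (D 1 ∷ []) _ = D∷[]
bandPath⇒banded₁ (D 1 ∷ U ∷ α) v = DU∷ bandPath⇒banded₁ α (bandPath-tail (bandPath-tail v))
bandPath⇒banded₁ (D 1 ∷ D k ∷ α) (_ , n , _) = ⊥-elim (¬NoDD-DD 1 k α n)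
bandPath⇒banded₁ (D 2 ∷ []) (_ , _ , _ , ())
bandPath⇒banded₁ (D 2 ∷ U ∷ α) v = D₂U∷ bandPath⇒banded₀ α (bandPath-tail (bandPath-tail v))
bandPath⇒banded₁ (D 2 ∷ D k ∷ α) (_ , n , _) = ⊥-elim (¬NoDD-DD 2 k α n)
bandPath⇒banded₁ (D (suc (suc (suc k))) ∷ α) (_ , _ , (_ , b) , _) =
  ⊥-elim (below-band k (headBand α b))

banded₀⇒bandPath : ∀ {α} → Banded₀ α → BandPath (+ 0) α
banded₁⇒bandPath : ∀ {α} → Banded₁ α → BandPath (+ 1) α

banded₀⇒bandPath []        = [] , tt , band₀ , refl
banded₀⇒bandPath (U∷ β)    = bandPath-U band₀ (banded₁⇒bandPath β)
banded₀⇒bandPath (DU∷ β)   = bandPath-DU band₀ (bandPath-U band₋₁ (banded₀⇒bandPath β))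

banded₁⇒bandPath D∷[]      = inj₂ (0 , refl) ∷ [] , tt , (band₁ , band₀) , refl
banded₁⇒bandPath (DU∷ β)   = bandPath-DU band₁ (bandPath-U band₀ (banded₁⇒bandPath β))
banded₁⇒bandPath (D₂U∷ β)  = bandPath-DU band₁ (bandPath-U band₋₁ (banded₀⇒bandPath β))

DU^ : ℕ → Path
DU^ zero    = []
DU^ (suc a) = D 1 ∷ U ∷ DU^ a

UD^ : ℕ → Path
UD^ zero    = []
UD^ (suc b) = U ∷ D 1 ∷ UD^ b

oddBlock : ℕ → Path
oddBlock i = U ∷ DU^ i

evenBlock : ℕ → Path
evenBlock j = D 2 ∷ U ∷ DU^ j

pairsThen : List (ℕ × ℕ) → Path → Path
pairsThen []             τ = τ
pairsThen ((i , j) ∷ ps) τ = oddBlock i ++ evenBlock j ++ pairsThen ps τ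

normal : ℕ → List (ℕ × ℕ) → ℕ → Path
normal a ps b = DU^ a ++ pairsThen ps (UD^ b)

Normal : Path → Set
Normal α = ∃[ a ] ∃[ ps ] ∃[ b ] α ≡ normal a ps b

banded₀-DU^ : ∀ a {α} → Banded₀ α → Banded₀ (DU^ a ++ α)
banded₀-DU^ zero    β = β
banded₀-DU^ (suc a) β = DU∷ banded₀-DU^ a β

banded₁-DU^ : ∀ a {α} → Banded₁ α → Banded₁ (DU^ a ++ α)
banded₁-DU^ zero    β = β
banded₁-DU^ (suc a) β = DU∷ banded₁-DU^ a β

banded₁-D∷UD^ : ∀ b → Banded₁ (D 1 ∷ UD^ b)
banded₁-D∷UD^ zero    = D∷[]
banded₁-D∷UD^ (suc b) = DU∷ banded₁-D∷UD^ b

banded₀-UD^ : ∀ b → Banded₀ (UD^ b)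
banded₀-UD^ zero    = []
banded₀-UD^ (suc b) = U∷ banded₁-D∷UD^ b

banded₀-pairsThen : ∀ ps {τ} → Banded₀ τ → Banded₀ (pairsThen ps τ)
banded₀-pairsThen []             β = β
banded₀-pairsThen ((i , j) ∷ ps) β = U∷ banded₁-DU^ i (D₂U∷ banded₀-DU^ j (banded₀-pairsThen ps β))

banded₀-normal : ∀ a ps b → Banded₀ (normal a ps b)
banded₀-normal a ps b = banded₀-DU^ a (banded₀-pairsThen ps (banded₀-UD^ b))

banded₀⇒normal : ∀ {α} → Banded₀ α → Normal α
banded₁⇒normal : ∀ {α} → Banded₁ α →
  (∃[ i ] ∃[ j ] ∃[ ps ] ∃[ b ] α ≡ DU^ i ++ evenBlock j ++ pairsThen ps (UD^ b)) ⊎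
  (∃[ b ] α ≡ D 1 ∷ UD^ b)

banded₀⇒normal [] = 0 , [] , 0 , refl
banded₀⇒normal (U∷ β) with banded₁⇒normal β
... | inj₁ (i , j , ps , b , refl) = 0 , (i , j) ∷ ps , b , refl
... | inj₂ (b , refl)              = 0 , [] , suc b , refl
banded₀⇒normal (DU∷ β) with banded₀⇒normal β
... | a , ps , b , refl = suc a , ps , b , refl

banded₁⇒normal D∷[] = inj₂ (0 , refl)
banded₁⇒normal (DU∷ β) with banded₁⇒normal β
... | inj₁ (i , j , ps , b , refl) = inj₁ (suc i , j , ps , b , refl)
... | inj₂ (b , refl)              = inj₂ (suc b , refl)
banded₁⇒normal (D₂U∷ β) with banded₀⇒normal β
... | j , ps , b , refl = inj₁ (0 , j , ps , b , refl)

EndsWithU : Path → Set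
EndsWithU []          = ⊥
EndsWithU (U ∷ [])    = ⊤
EndsWithU (D _ ∷ [])  = ⊥
EndsWithU (_ ∷ s ∷ α) = EndsWithU (s ∷ α)

CutOrEmpty : Path → Set
CutOrEmpty []      = ⊤
CutOrEmpty (s ∷ _) = cutBefore s ≡ true

-- blocks [] is [] ∷ [], whereas the empty path has no blocks.
properBlocks : Path → List Path
properBlocks []        = []
properBlocks α@(_ ∷ _) = blocks α

consHead-++ : ∀ s {Bs} Cs → Bs ≢ [] → consHead s (Bs ++ Cs) ≡ consHead s Bs ++ Cs
consHead-++ s {[]}    Cs Bs≢[] = ⊥-elim (Bs≢[] refl)
consHead-++ s {_ ∷ _} Cs _     = refl

consHead-≢-[] : ∀ s Bs → consHead s Bs ≢ []
consHead-≢-[] s []      ()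
consHead-≢-[] s (_ ∷ _) ()

blocks-≢-[] : ∀ α → blocks α ≢ []
blocks-≢-[] []          ()
blocks-≢-[] (U ∷ [])    ()
blocks-≢-[] (U ∷ s ∷ α) with cutBefore s
... | true  = λ ()
... | false = consHead-≢-[] U _
blocks-≢-[] (D k ∷ α)   = consHead-≢-[] (D k) _

blocks-++ : ∀ α {β} → EndsWithU α → CutOrEmpty β → blocks (α ++ β) ≡ blocks α ++ properBlocks β
blocks-++ (U ∷ [])    {[]}    _ _   = refl
blocks-++ (U ∷ [])    {_ ∷ _} _ cut rewrite cut = refl
blocks-++ (U ∷ s ∷ α) end cut with cutBefore s | blocks-++ (s ∷ α) end cut
... | true  | ih = cong ((U ∷ []) ∷_) ih
... | false | ih = trans (cong (consHead U) ih) (consHead-++ U _ (blocks-≢-[] (s ∷ α)))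
blocks-++ (D k ∷ s ∷ α) end cut =
  trans (cong (consHead (D k)) (blocks-++ (s ∷ α) end cut))
        (consHead-++ (D k) _ (blocks-≢-[] (s ∷ α)))

endsWithU-oddBlock : ∀ i → EndsWithU (oddBlock i)
endsWithU-oddBlock zero    = tt
endsWithU-oddBlock (suc i) = endsWithU-oddBlock i

blocks-oddBlock : ∀ i → blocks (oddBlock i) ≡ oddBlock i ∷ []
blocks-oddBlock zero    = refl
blocks-oddBlock (suc i) rewrite blocks-oddBlock i = refl

blocks-evenBlock : ∀ j → blocks (evenBlock j) ≡ evenBlock j ∷ []
blocks-evenBlock j rewrite blocks-oddBlock j = refl

blocks-DU^ : ∀ a → blocks (DU^ (suc a)) ≡ DU^ (suc a) ∷ []
blocks-DU^ a rewrite blocks-oddBlock a = refl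

blocks-UD^ : ∀ b → blocks (UD^ b) ≡ UD^ b ∷ []
blocks-UD^ zero    = refl
blocks-UD^ (suc b) rewrite blocks-UD^ b = refl

cutOrEmpty-pairsThen : ∀ ps b → CutOrEmpty (pairsThen ps (UD^ b))
cutOrEmpty-pairsThen []      zero    = tt
cutOrEmpty-pairsThen []      (suc b) = refl
cutOrEmpty-pairsThen (_ ∷ _) b       = refl

runBlock : Path → List Path
runBlock []        = []
runBlock B@(_ ∷ _) = B ∷ []

pairBlocks : List (ℕ × ℕ) → List Path
pairBlocks []             = []
pairBlocks ((i , j) ∷ ps) = oddBlock i ∷ evenBlock j ∷ pairBlocks ps

normalBlocks : ℕ → List (ℕ × ℕ) → ℕ → List Path
normalBlocks a ps b = runBlock (DU^ a) ++ pairBlocks ps ++ runBlock (UD^ b)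

properBlocks-pairsThen : ∀ ps b →
  properBlocks (pairsThen ps (UD^ b)) ≡ pairBlocks ps ++ runBlock (UD^ b)
properBlocks-pairsThen []             zero    = refl
properBlocks-pairsThen []             (suc b) = blocks-UD^ (suc b)
properBlocks-pairsThen ((i , j) ∷ ps) b       = begin
  blocks (oddBlock i ++ evenBlock j ++ τ)
    ≡⟨ blocks-++ (oddBlock i) (endsWithU-oddBlock i) refl ⟩
  blocks (oddBlock i) ++ blocks (evenBlock j ++ τ)
    ≡⟨ cong₂ _++_ (blocks-oddBlock i)
                  (blocks-++ (evenBlock j) (endsWithU-oddBlock j) (cutOrEmpty-pairsThen ps b)) ⟩
  oddBlock i ∷ blocks (evenBlock j) ++ properBlocks τ
    ≡⟨ cong₂ (λ B Bs → oddBlock i ∷ B ++ Bs) (blocks-evenBlock j) (properBlocks-pairsThen ps b) ⟩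
  oddBlock i ∷ evenBlock j ∷ pairBlocks ps ++ runBlock (UD^ b) ∎
  where τ = pairsThen ps (UD^ b)

properBlocks-normal : ∀ a ps b → properBlocks (normal a ps b) ≡ normalBlocks a ps b
properBlocks-normal zero    ps b = properBlocks-pairsThen ps b
properBlocks-normal (suc a) ps b = begin
  blocks (DU^ (suc a) ++ pairsThen ps (UD^ b))
    ≡⟨ blocks-++ (DU^ (suc a)) (endsWithU-oddBlock a) (cutOrEmpty-pairsThen ps b) ⟩
  blocks (DU^ (suc a)) ++ properBlocks (pairsThen ps (UD^ b))
    ≡⟨ cong₂ _++_ (blocks-DU^ a) (properBlocks-pairsThen ps b) ⟩
  normalBlocks (suc a) ps b ∎

length-DU^ : ∀ a → length (DU^ a) ≡ double a
length-DU^ zero    = refl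
length-DU^ (suc a) = cong (suc ∘ suc) (length-DU^ a)

length-UD^ : ∀ b → length (UD^ b) ≡ double b
length-UD^ zero    = refl
length-UD^ (suc b) = cong (suc ∘ suc) (length-UD^ b)

length-oddBlock : ∀ i → length (oddBlock i) ≡ odd i
length-oddBlock i = cong suc (length-DU^ i)

length-evenBlock : ∀ j → length (evenBlock j) ≡ even⁺ j
length-evenBlock j = cong (suc ∘ suc) (length-DU^ j)

runLengths : ℕ → List ℕ
runLengths zero    = []
runLengths (suc a) = double (suc a) ∷ []

oddEvenParts : List (ℕ × ℕ) → List ℕ
oddEvenParts []             = []
oddEvenParts ((i , j) ∷ ps) = odd i ∷ even⁺ j ∷ oddEvenParts ps

evenOddParts : List (ℕ × ℕ) → List ℕ
evenOddParts []             = []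
evenOddParts ((i , j) ∷ qs) = even⁺ j ∷ odd i ∷ evenOddParts qs

composition : ℕ → List (ℕ × ℕ) → ℕ → List ℕ
composition a qs b = odd b ∷ evenOddParts qs ++ even⁺ a ∷ []

evenOddParts-++ : ∀ qs qs′ → evenOddParts (qs ++ qs′) ≡ evenOddParts qs ++ evenOddParts qs′
evenOddParts-++ []             qs′ = refl
evenOddParts-++ ((i , j) ∷ qs) qs′ = cong (λ E → even⁺ j ∷ odd i ∷ E) (evenOddParts-++ qs qs′)

reverse-oddEvenParts : ∀ ps → reverse (oddEvenParts ps) ≡ evenOddParts (reverse ps)
reverse-oddEvenParts []             = refl
reverse-oddEvenParts ((i , j) ∷ ps) = begin
  reverse (odd i ∷ even⁺ j ∷ oddEvenParts ps)
    ≡⟨ unfold-reverse (odd i) (even⁺ j ∷ oddEvenParts ps) ⟩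
  reverse (even⁺ j ∷ oddEvenParts ps) ∷ʳ odd i
    ≡⟨ cong (_∷ʳ odd i) (unfold-reverse (even⁺ j) (oddEvenParts ps)) ⟩
  (reverse (oddEvenParts ps) ∷ʳ even⁺ j) ∷ʳ odd i
    ≡⟨ ++-assoc (reverse (oddEvenParts ps)) _ _ ⟩
  reverse (oddEvenParts ps) ++ evenOddParts ((i , j) ∷ [])
    ≡⟨ cong (_++ _) (reverse-oddEvenParts ps) ⟩
  evenOddParts (reverse ps) ++ evenOddParts ((i , j) ∷ [])
    ≡⟨ evenOddParts-++ (reverse ps) _ ⟨
  evenOddParts (reverse ps ∷ʳ (i , j))
    ≡⟨ cong evenOddParts (unfold-reverse (i , j) ps) ⟨
  evenOddParts (reverse ((i , j) ∷ ps)) ∎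

reverse-runLengths : ∀ a → reverse (runLengths a) ≡ runLengths a
reverse-runLengths zero    = refl
reverse-runLengths (suc a) = refl

map-length-runBlock-DU^ : ∀ a → map length (runBlock (DU^ a)) ≡ runLengths a
map-length-runBlock-DU^ zero    = refl
map-length-runBlock-DU^ (suc a) = cong (_∷ []) (length-DU^ (suc a))

map-length-runBlock-UD^ : ∀ b → map length (runBlock (UD^ b)) ≡ runLengths b
map-length-runBlock-UD^ zero    = refl
map-length-runBlock-UD^ (suc b) = cong (_∷ []) (length-UD^ (suc b))

map-length-pairBlocks : ∀ ps → map length (pairBlocks ps) ≡ oddEvenParts ps
map-length-pairBlocks []             = refl
map-length-pairBlocks ((i , j) ∷ ps) =
  cong₂ _∷_ (length-oddBlock i) (cong₂ _∷_ (length-evenBlock j) (map-length-pairBlocks ps))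

map-length-normalBlocks : ∀ a ps b →
  map length (normalBlocks a ps b) ≡ runLengths a ++ oddEvenParts ps ++ runLengths b
map-length-normalBlocks a ps b = begin
  map length (runBlock (DU^ a) ++ pairBlocks ps ++ runBlock (UD^ b))
    ≡⟨ map-++ length (runBlock (DU^ a)) _ ⟩
  map length (runBlock (DU^ a)) ++ map length (pairBlocks ps ++ runBlock (UD^ b))
    ≡⟨ cong (map length (runBlock (DU^ a)) ++_) (map-++ length (pairBlocks ps) _) ⟩
  map length (runBlock (DU^ a)) ++ map length (pairBlocks ps) ++ map length (runBlock (UD^ b))
    ≡⟨ cong₂ _++_ (map-length-runBlock-DU^ a)
                  (cong₂ _++_ (map-length-pairBlocks ps) (map-length-runBlock-UD^ b)) ⟩
  runLengths a ++ oddEvenParts ps ++ runLengths b ∎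

reverse-blockLengths : ∀ a ps b →
  reverse (map length (normalBlocks a ps b)) ≡
  runLengths b ++ evenOddParts (reverse ps) ++ runLengths a
reverse-blockLengths a ps b = begin
  reverse (map length (normalBlocks a ps b))
    ≡⟨ cong reverse (map-length-normalBlocks a ps b) ⟩
  reverse (runLengths a ++ oddEvenParts ps ++ runLengths b)
    ≡⟨ reverse-++ (runLengths a) _ ⟩
  reverse (oddEvenParts ps ++ runLengths b) ++ reverse (runLengths a)
    ≡⟨ cong₂ _++_ (reverse-++ (oddEvenParts ps) (runLengths b)) (reverse-runLengths a) ⟩
  (reverse (runLengths b) ++ reverse (oddEvenParts ps)) ++ runLengths a
    ≡⟨ cong₂ (λ R E → (R ++ E) ++ runLengths a) (reverse-runLengths b) (reverse-oddEvenParts ps) ⟩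
  (runLengths b ++ evenOddParts (reverse ps)) ++ runLengths a
    ≡⟨ ++-assoc (runLengths b) _ _ ⟩
  runLengths b ++ evenOddParts (reverse ps) ++ runLengths a ∎

data SeveralBlocks : ℕ → List (ℕ × ℕ) → ℕ → Set where
  pairs : ∀ {a p ps b} → SeveralBlocks a (p ∷ ps) b
  runs  : ∀ {a b} → SeveralBlocks (suc a) [] (suc b)

several-reverse : ∀ {a ps b} → SeveralBlocks a ps b → SeveralBlocks a (reverse ps) b
several-reverse runs = runs
several-reverse {a} {b = b} (pairs {p = p} {ps}) =
  subst (λ qs → SeveralBlocks a qs b) (sym (unfold-reverse p ps)) (several-∷ʳ (reverse ps))
  where
  several-∷ʳ : ∀ qs → SeveralBlocks a (qs ∷ʳ p) b
  several-∷ʳ []      = pairs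
  several-∷ʳ (_ ∷ _) = pairs

modify₁-several : ∀ {a qs b} → SeveralBlocks a qs b →
  modify₁ (runLengths b ++ evenOddParts qs ++ runLengths a) ≡
  odd b ∷ evenOddParts qs ++ runLengths a
modify₁-several {qs = (i , _) ∷ _} {b = zero}  pairs rewrite even-double i = refl
modify₁-several {qs = (_ , j) ∷ _} {b = suc _} pairs rewrite even-double j = refl
modify₁-several {a = suc a}                    runs  rewrite even-double a = refl

modify₂ : List ℕ → List ℕ
modify₂ L = reverse (modify₂ʳ (reverse L))

modify₂ʳ-runLengths : ∀ a k S → modify₂ʳ (runLengths a ++ odd k ∷ S) ≡ even⁺ a ∷ odd k ∷ S
modify₂ʳ-runLengths zero    k S rewrite even-double k = refl
modify₂ʳ-runLengths (suc a) k S rewrite even-double a =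
  cong (_∷ odd k ∷ S) (+-comm (double (suc a)) 2)

modify₂-∷ʳodd : ∀ Y k a → modify₂ ((Y ∷ʳ odd k) ++ runLengths a) ≡ (Y ∷ʳ odd k) ∷ʳ even⁺ a
modify₂-∷ʳodd Y k a = begin
  reverse (modify₂ʳ (reverse ((Y ∷ʳ odd k) ++ runLengths a)))
    ≡⟨ cong (reverse ∘ modify₂ʳ) (reverse-++ (Y ∷ʳ odd k) (runLengths a)) ⟩
  reverse (modify₂ʳ (reverse (runLengths a) ++ reverse (Y ∷ʳ odd k)))
    ≡⟨ cong₂ (λ R Z → reverse (modify₂ʳ (R ++ Z)))
             (reverse-runLengths a) (reverse-++ Y (odd k ∷ [])) ⟩
  reverse (modify₂ʳ (runLengths a ++ odd k ∷ reverse Y))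
    ≡⟨ cong reverse (modify₂ʳ-runLengths a k (reverse Y)) ⟩
  reverse (even⁺ a ∷ odd k ∷ reverse Y)
    ≡⟨ unfold-reverse (even⁺ a) (odd k ∷ reverse Y) ⟩
  reverse (odd k ∷ reverse Y) ∷ʳ even⁺ a
    ≡⟨ cong (_∷ʳ even⁺ a) (unfold-reverse (odd k) (reverse Y)) ⟩
  (reverse (reverse Y) ∷ʳ odd k) ∷ʳ even⁺ a
    ≡⟨ cong (λ Z → (Z ∷ʳ odd k) ∷ʳ even⁺ a) (reverse-involutive Y) ⟩
  (Y ∷ʳ odd k) ∷ʳ even⁺ a ∎

lastPart-odd : ∀ b qs → ∃₂ λ Y k → odd b ∷ evenOddParts qs ≡ Y ∷ʳ odd k
lastPart-odd b []             = [] , b , refl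
lastPart-odd b ((i , j) ∷ qs) with lastPart-odd i qs
... | Y , k , eq = odd b ∷ even⁺ j ∷ Y , k , cong (λ Z → odd b ∷ even⁺ j ∷ Z) eq

φ-manyBlocks : ∀ α {B₁ B₂ Bs} → properBlocks α ≡ B₁ ∷ B₂ ∷ Bs →
  φ α ≡ modify₂ (modify₁ (reverse (map length (B₁ ∷ B₂ ∷ Bs))))
φ-manyBlocks []      ()
φ-manyBlocks (s ∷ α) eq rewrite eq = refl

φ-unfold : ∀ {a ps b} → SeveralBlocks a ps b →
  φ (normal a ps b) ≡ modify₂ (modify₁ (reverse (map length (normalBlocks a ps b))))
φ-unfold {zero}  {ps} {b} pairs = φ-manyBlocks (normal zero ps b) (properBlocks-normal zero ps b)
φ-unfold {suc a} {ps} {b} pairs =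
  φ-manyBlocks (normal (suc a) ps b) (properBlocks-normal (suc a) ps b)
φ-unfold {a}     {_}  {b} runs  = φ-manyBlocks (normal a [] b) (properBlocks-normal a [] b)

φ-several : ∀ {a ps b} → SeveralBlocks a ps b → φ (normal a ps b) ≡ composition a (reverse ps) b
φ-several {a} {ps} {b} several with lastPart-odd b (reverse ps)
... | Y , k , lastOdd = begin
  φ (normal a ps b)
    ≡⟨ φ-unfold several ⟩
  modify₂ (modify₁ (reverse (map length (normalBlocks a ps b))))
    ≡⟨ cong (modify₂ ∘ modify₁) (reverse-blockLengths a ps b) ⟩
  modify₂ (modify₁ (runLengths b ++ evenOddParts (reverse ps) ++ runLengths a))
    ≡⟨ cong modify₂ (modify₁-several (several-reverse several)) ⟩
  modify₂ ((odd b ∷ evenOddParts (reverse ps)) ++ runLengths a)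
    ≡⟨ cong (λ Z → modify₂ (Z ++ runLengths a)) lastOdd ⟩
  modify₂ ((Y ∷ʳ odd k) ++ runLengths a)
    ≡⟨ modify₂-∷ʳodd Y k a ⟩
  (Y ∷ʳ odd k) ∷ʳ even⁺ a
    ≡⟨ cong (_∷ʳ even⁺ a) lastOdd ⟨
  composition a (reverse ps) b ∎

φ-DU^ : ∀ a → φ (DU^ (suc a)) ≡ composition (suc a) [] 0
φ-DU^ a rewrite blocks-oddBlock a = cong (λ n → 1 ∷ n ∷ []) (begin
  length (DU^ (suc a)) + 2  ≡⟨ cong (_+ 2) (length-DU^ (suc a)) ⟩
  double (suc a) + 2        ≡⟨ +-comm (double (suc a)) 2 ⟩
  even⁺ (suc a)             ∎)

φ-UD^ : ∀ b → φ (UD^ (suc b)) ≡ composition 0 [] (suc b)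
φ-UD^ b rewrite blocks-UD^ b = cong (λ n → suc n ∷ 2 ∷ []) (length-UD^ (suc b))

φ-normal : ∀ a ps b → φ (normal a ps b) ≡ composition a (reverse ps) b
φ-normal zero    []         zero    = refl
φ-normal (suc a) []         zero    = trans (cong φ (++-identityʳ (DU^ (suc a)))) (φ-DU^ a)
φ-normal zero    []         (suc b) = φ-UD^ b
φ-normal (suc a) []         (suc b) = φ-several {suc a} {[]} {suc b} runs
φ-normal a       ps@(_ ∷ _) b       = φ-several {a} {ps} {b} pairs

length-pairsThen : ∀ ps τ → length (pairsThen ps τ) ≡ sum (oddEvenParts ps) + length τ
length-pairsThen []             τ = refl
length-pairsThen ((i , j) ∷ ps) τ = begin
  length (oddBlock i ++ evenBlock j ++ pairsThen ps τ)
    ≡⟨ length-++ (oddBlock i) ⟩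
  length (oddBlock i) + length (evenBlock j ++ pairsThen ps τ)
    ≡⟨ cong (λ n → length (oddBlock i) + n) (length-++ (evenBlock j)) ⟩
  length (oddBlock i) + (length (evenBlock j) + length (pairsThen ps τ))
    ≡⟨ cong₂ (λ m n → m + (n + length (pairsThen ps τ))) (length-oddBlock i) (length-evenBlock j) ⟩
  odd i + (even⁺ j + length (pairsThen ps τ))
    ≡⟨ cong (λ n → odd i + (even⁺ j + n)) (length-pairsThen ps τ) ⟩
  odd i + (even⁺ j + (sum (oddEvenParts ps) + length τ))
    ≡⟨ cong (λ n → odd i + n) (+-assoc (even⁺ j) _ _) ⟨
  odd i + (even⁺ j + sum (oddEvenParts ps) + length τ)
    ≡⟨ +-assoc (odd i) _ _ ⟨
  odd i + (even⁺ j + sum (oddEvenParts ps)) + length τ ∎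

sum-evenOddParts-reverse : ∀ ps → sum (evenOddParts (reverse ps)) ≡ sum (oddEvenParts ps)
sum-evenOddParts-reverse ps = begin
  sum (evenOddParts (reverse ps))  ≡⟨ cong sum (reverse-oddEvenParts ps) ⟨
  sum (reverse (oddEvenParts ps))  ≡⟨ sum-↭ (↭-reverse (oddEvenParts ps)) ⟩
  sum (oddEvenParts ps)            ∎

length-normal : ∀ a ps b → length (normal a ps b) + 3 ≡ sum (composition a (reverse ps) b)
length-normal a ps b = begin
  length (DU^ a ++ pairsThen ps (UD^ b)) + 3
    ≡⟨ cong (_+ 3) (length-++ (DU^ a)) ⟩
  length (DU^ a) + length (pairsThen ps (UD^ b)) + 3
    ≡⟨ cong (λ n → length (DU^ a) + n + 3) (length-pairsThen ps (UD^ b)) ⟩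
  length (DU^ a) + (P + length (UD^ b)) + 3
    ≡⟨ cong₂ (λ m n → m + (P + n) + 3) (length-DU^ a) (length-UD^ b) ⟩
  double a + (P + double b) + 3
    ≡⟨ shuffle (double a) P (double b) ⟩
  odd b + (P + (even⁺ a + 0))
    ≡⟨ cong (λ s → odd b + (s + (even⁺ a + 0))) (sum-evenOddParts-reverse ps) ⟨
  odd b + (sum (evenOddParts (reverse ps)) + sum (even⁺ a ∷ []))
    ≡⟨ cong (λ n → odd b + n) (sum-++ (evenOddParts (reverse ps)) _) ⟨
  sum (composition a (reverse ps) b) ∎
  where
  P = sum (oddEvenParts ps)
  shuffle : ∀ x s y → x + (s + y) + 3 ≡ suc y + (s + (suc (suc x) + 0))
  shuffle = solve-∀

positive-evenOddParts : ∀ qs → All (1 ≤_) (evenOddParts qs)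
positive-evenOddParts []       = []
positive-evenOddParts (_ ∷ qs) = s≤s z≤n ∷ s≤s z≤n ∷ positive-evenOddParts qs

lastEven-++ : ∀ x zs {y} → even y ≡ true → LastEven (x ∷ zs ++ y ∷ [])
lastEven-++ x []       e = e
lastEven-++ x (z ∷ zs) e = lastEven-++ z zs e

alternating-composition : ∀ a qs b → Alternating (composition a qs b)
alternating-composition a []             b = odd≢even⁺ b a , tt
alternating-composition a ((i , j) ∷ qs) b =
  odd≢even⁺ b j , odd≢even⁺ i j ∘ sym , alternating-composition a qs i

composition-C' : ∀ {m} a qs b → sum (composition a qs b) ≡ m → C' m (composition a qs b)
composition-C' a qs b sum≡m =
  (s≤s z≤n ∷ ++⁺ (positive-evenOddParts qs) (s≤s z≤n ∷ []) , sum≡m) ,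
  even-odd b ,
  lastEven-++ (odd b) (evenOddParts qs) (even-double (suc a)) ,
  alternating-composition a qs b

evenOddParts-injective : ∀ {qs qs′} → evenOddParts qs ≡ evenOddParts qs′ → qs ≡ qs′
evenOddParts-injective {[]}          {[]}            _  = refl
evenOddParts-injective {(i , j) ∷ _} {(i′ , j′) ∷ _} eq with ∷-injective eq
... | j≡j′ , eq′ with ∷-injective eq′
... | i≡i′ , eq″ =
  cong₂ _∷_ (cong₂ _,_ (odd-injective i≡i′) (even⁺-injective j≡j′)) (evenOddParts-injective eq″)
evenOddParts-injective {[]}    {_ ∷ _} ()
evenOddParts-injective {_ ∷ _} {[]}    ()

composition-injective : ∀ {a qs b a′ qs′ b′} → composition a qs b ≡ composition a′ qs′ b′ →
  a ≡ a′ × qs ≡ qs′ × b ≡ b′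
composition-injective {qs = qs} {qs′ = qs′} eq with ∷-injective eq
... | b≡b′ , eq′ with ∷ʳ-injective (evenOddParts qs) (evenOddParts qs′) eq′
... | parts≡ , a≡a′ = even⁺-injective a≡a′ , evenOddParts-injective parts≡ , odd-injective b≡b′

evenStart-form : ∀ {y rest} → even y ≡ true → All (1 ≤_) (y ∷ rest) → LastEven (y ∷ rest) →
  Alternating (y ∷ rest) → ∃₂ λ qs a → y ∷ rest ≡ evenOddParts qs ++ even⁺ a ∷ []
evenStart-form {y} {[]} e (pos ∷ _) _ _ with even⁺-view y e pos
... | a , refl = [] , a , refl
evenStart-form {y} {z ∷ []} e _ last (y≢z , _) =
  contradiction (trans (sym last) (parity-flips y z y≢z e)) λ ()
evenStart-form {y} {z ∷ w ∷ _} e (pos ∷ _ ∷ poss) last (y≢z , z≢w , alt)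
  with even⁺-view y e pos | odd-view z (parity-flips y z y≢z e)
     | evenStart-form (parity-flips z w z≢w (parity-flips y z y≢z e)) poss last alt
... | j , refl | i , refl | qs , a , eq = (i , j) ∷ qs , a , cong (λ t → even⁺ j ∷ odd i ∷ t) eq

C'-composition : ∀ {m c} → C' m c → ∃[ a ] ∃[ qs ] ∃[ b ] c ≡ composition a qs b
C'-composition {c = []}    (_ , () , _)
C'-composition {c = _ ∷ []} (_ , first , last , _) = contradiction (trans (sym first) last) λ ()
C'-composition {c = x ∷ y ∷ _} ((_ ∷ poss , _) , first , last , x≢y , alt)
  with odd-view x first | evenStart-form (parity-flips x y x≢y first) poss last alt
... | b , refl | qs , a , eq = a , qs , b , cong (odd b ∷_) eq

G⇒normal : ∀ {n α} → G n α → Normal α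
G⇒normal {α = α} ((legal , noDD , end) , _ , band) =
  banded₀⇒normal (bandPath⇒banded₀ α (legal , noDD , band , end))

normal-G : ∀ {n} a ps b → length (normal a ps b) ≡ n → G n (normal a ps b)
normal-G a ps b len with banded₀⇒bandPath (banded₀-normal a ps b)
... | legal , noDD , band , end = (legal , noDD , end) , len , band

φ-maps-into-C' : ∀ n α → G n α → C' (n + 3) (φ α)
φ-maps-into-C' n α g@(_ , len , _) with G⇒normal g
... | a , ps , b , refl rewrite φ-normal a ps b =
  composition-C' a (reverse ps) b (trans (sym (length-normal a ps b)) (cong (_+ 3) len))

φ-injective : ∀ n α β → G n α → G n β → φ α ≡ φ β → α ≡ β
φ-injective n α β gα gβ eq with G⇒normal gα | G⇒normal gβ
... | a , ps , b , refl | a′ , ps′ , b′ , refl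
  with composition-injective (trans (sym (φ-normal a ps b)) (trans eq (φ-normal a′ ps′ b′)))
... | refl , reverse≡ , refl =
  cong (λ ps → normal a ps b) (reverse-injective {x = ps} {y = ps′} reverse≡)

φ-onto : ∀ n c → C' (n + 3) c → Σ Path (λ α → G n α × φ α ≡ c)
φ-onto n c c∈C'@((_ , sum≡) , _) with C'-composition c∈C'
... | a , qs , b , refl = normal a (reverse qs) b , normal-G a (reverse qs) b len , φ≡
  where
  reverse-twice : composition a (reverse (reverse qs)) b ≡ composition a qs b
  reverse-twice = cong (λ ps → composition a ps b) (reverse-involutive qs)
  φ≡ : φ (normal a (reverse qs) b) ≡ composition a qs b
  φ≡ = trans (φ-normal a (reverse qs) b) reverse-twice
  len : length (normal a (reverse qs) b) ≡ n
  len = +-cancelʳ-≡ 3 _ _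
          (trans (length-normal a (reverse qs) b) (trans (cong sum reverse-twice) sum≡))

theorem7 : (n : ℕ) →
    ((α : Path) → G n α → C' (n + 3) (φ α)) ×
    ((α β : Path) → G n α → G n β → φ α ≡ φ β → α ≡ β) ×
    ((c : List ℕ) → C' (n + 3) c → Σ Path (λ α → G n α × φ α ≡ c))
theorem7 n = φ-maps-into-C' n , φ-injective n , φ-onto n
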